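{- For every integer $n\ge3$, $F_3(n,6)\ge \frac25$.
   Context: $S_n$ is the set of permutations of $[n]$, viewed as linear orderings of $[n]$. For $P\in S_n$ and a 3-element $X\subseteq[n]$, $P_X\in S_3$ is the pattern (relative order) of $X$ in $P$. A family $\mathcal S\subseteq S_n$ shatters $X$ if $\{P_X:P\in\mathcal S\}=S_3$. $F_3(n,m)$ is the largest $\alpha\in[0,1]$ such that some collection of exactly $m$ permutations from $S_n$ shatters $\alpha\binom n3$ of the 3-element subsets of $[n]$. -}

module Defs where

open import Data.Nat using (ℕ; zero; suc; _*_; _≤_)
open import Data.Nat.Combinatorics using (_C_)
open import Data.Fin using (Fin; _<_; _<?_)
open import Data.Fin.Properties using (any?)
open import Data.Fin.Permutation using (Permutation′; _⟨$⟩ʳ_; _≈_)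
open import Data.List using (List; allFin; concatMap; map; filter; length)
open import Data.Product using (_×_; _,_; ∃; Σ)
open import Relation.Nullary using (Dec; ¬_)
open import Relation.Nullary.Decidable using (_×-dec_)
open import Relation.Binary.PropositionalEquality using (_≢_)

-- A permutation P of [n] = Fin n is read as the linear ordering
--   x ≺_P y  iff  P x < P y   (P x is the position/rank of x).
-- Every linear ordering of Fin n arises from exactly one such P.

InOrder : ∀ {n} → Permutation′ n → Fin n → Fin n → Fin n → Set
InOrder P x y z = (P ⟨$⟩ʳ x < P ⟨$⟩ʳ y) × (P ⟨$⟩ʳ y < P ⟨$⟩ʳ z)

inOrder? : ∀ {n} (P : Permutation′ n) x y z → Dec (InOrder P x y z)
inOrder? P x y z = (P ⟨$⟩ʳ x <? P ⟨$⟩ʳ y) ×-dec (P ⟨$⟩ʳ y <? P ⟨$⟩ʳ z)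

Family : ℕ → ℕ → Set
Family m n = Fin m → Permutation′ n

Realised : ∀ {m n} → Family m n → Fin n → Fin n → Fin n → Set
Realised F x y z = ∃ λ k → InOrder (F k) x y z

realised? : ∀ {m n} (F : Family m n) x y z → Dec (Realised F x y z)
realised? F x y z = any? (λ k → inOrder? (F k) x y z)

Shatters : ∀ {m n} → Family m n → Fin n → Fin n → Fin n → Set
Shatters F a b c =
  Realised F a b c × Realised F a c b × Realised F b a c ×
  Realised F b c a × Realised F c a b × Realised F c b a

shatters? : ∀ {m n} (F : Family m n) a b c → Dec (Shatters F a b c)
shatters? F a b c =
  realised? F a b c ×-dec realised? F a c b ×-dec realised? F b a c ×-dec
  realised? F b c a ×-dec realised? F c a b ×-dec realised? F c b a

-- 3-element subsets of Fin n, represented as increasing triples a < b < c.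
Triple : ℕ → Set
Triple n = Fin n × Fin n × Fin n

allTriples : (n : ℕ) → List (Triple n)
allTriples n =
  concatMap (λ a → concatMap (λ b → map (λ c → (a , b , c)) (allFin n)) (allFin n)) (allFin n)

IsShatteredSet : ∀ {m n} → Family m n → Triple n → Set
IsShatteredSet F (a , b , c) = (a < b) × (b < c) × Shatters F a b c

isShatteredSet? : ∀ {m n} (F : Family m n) (t : Triple n) → Dec (IsShatteredSet F t)
isShatteredSet? F (a , b , c) = (a <? b) ×-dec (b <? c) ×-dec shatters? F a b c

numShattered : ∀ {m n} → Family m n → ℕ
numShattered {n = n} F = length (filter (isShatteredSet? F) (allTriples n))

-- The members of the family are pairwise distinct permutations
-- (so the family is a collection of exactly m permutations).
Distinct : ∀ {m n} → Family m n → Set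
Distinct F = ∀ i j → i ≢ j → ¬ (F i ≈ F j)

-- F_3(n,m) ≥ p/q : some collection of exactly m permutations of [n]
-- shatters at least (p/q)·C(n,3) of the 3-subsets (the maximum over the
-- finitely many collections is ≥ p/q iff some collection attains ≥ p/q).
F3≥ : (n m p q : ℕ) → Set
F3≥ n m p q = Σ (Family m n) λ F → Distinct F × (p * (n C 3) ≤ q * numShattered F)

-- Six orderings σ₀, …, σ₅ of a six-letter alphabet shatter 15 of its 20 triples. Label every
-- a ∈ [n] by a mod 6 and let the k-th permutation order [n] by the σₖ-position of the label,
-- ties broken by the natural order; then every triple a < b < c whose labels form a shattered
-- triple is shattered. If N_u elements carry label u, this gives at least Σ N_u N_v N_w shattered
-- triples, the sum running over the 15 shattered label triples, i.e. T(N,N,N)/6 for the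
-- symmetric trilinear form T whose coefficients indicate shattered label triples. For
-- n = 6Q + R the block vector is N = Q·𝟙 + N(R), so the count is a cubic polynomial in Q with
-- leading coefficient 15, against 36 for C(n,3); since 5·15 > 2·36, comparing the two
-- polynomials in each residue class gives the ratio 2/5.

module Submission where

open import Defs
open import Data.Bool using (true; false; if_then_else_)
open import Data.Empty using (⊥-elim)
open import Data.Fin using (Fin; zero; suc; toℕ; fromℕ<; punchOut; combine; _↑ˡ_)
  renaming (_<_ to _<ᶠ_; _<?_ to _<ᶠ?_)
open import Data.Fin.Patterns using (0F; 1F; 2F; 3F; 4F; 5F)
open import Data.Fin.Permutation using (Permutation′; permutation; _⟨$⟩ʳ_; _≈_)
open import Data.Fin.Properties
  using (any?; all?; toℕ-injective; toℕ-fromℕ<; toℕ-↑ˡ; punchOut-injective; injective⇒≤;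
         combine-monoˡ-<; combine-injectiveʳ)
  renaming (_≟_ to _≟ᶠ_; <-irrefl to <ᶠ-irrefl; <-asym to <ᶠ-asym)
open import Data.List using (List; []; _∷_; allFin; map; filter; length; tabulate; concatMap)
open import Data.List.Membership.Propositional using (_∈_)
open import Data.List.Membership.Propositional.Properties using (∈-allFin)
open import Data.List.Properties using (length-tabulate; map-tabulate; map-++; map-cong; map-∘)
open import Data.List.Relation.Unary.Any using (here; there)
open import Data.Nat using (ℕ; zero; suc; _+_; _*_; _≤_; _<_; _<?_; _≟_; z≤n; s≤s)
open import Data.Nat.Combinatorics using (_C_; nCk+nC[k+1]≡[n+1]C[k+1]; nC1≡n)
open import Data.Nat.DivMod using (_/_; _%_; m≡m%n+[m/n]*n; m%n<n)
open import Data.Nat.ListAction using (sum)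
open import Data.Nat.ListAction.Properties using (sum-++)
open import Data.Nat.Properties
  using (module ≤-Reasoning; ≤-refl; ≤-trans; <-irrefl; <-cmp; <-trans; <-≤-trans; <⇒≤; ≤⇒≯;
         1+n≰n; n<1+n; m<n⇒m<1+n; m≤n⇒m<n∨m≡n; m<1+n⇒m≤n; m≤m+n; +-mono-≤; +-mono-<-≤; +-mono-≤-<;
         +-comm; +-assoc; +-suc; +-identityʳ; +-cancelʳ-≡; *-comm; *-assoc; *-zeroʳ; *-distribʳ-+;
         *-distribˡ-+; *-cancelˡ-≤; *-monoʳ-≤; +-*-semiring)
open import Algebra.Properties.Semiring.Sum +-*-semiring
  using (∑-distrib-+; ∑-comm; *-distribˡ-sum; sum-cong-≗; sum-replicate-zero) renaming (sum to ∑)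
open import Data.Nat.Tactic.RingSolver using (solve-∀)
open import Data.Product using (_×_; _,_; ∃; ∃₂; proj₁; proj₂)
open import Data.Sum using (inj₁; inj₂)
open import Data.Vec using (Vec; []; _∷_; lookup)
open import Data.Vec.Functional using (Vector; zipWith) renaming (map to mapᵛ)
open import Function using (_∘_)
open import Function.Bundles using (_⇔_; mk⇔)
open import Function.Definitions using (Injective)
open import Relation.Binary using (tri<; tri≈; tri>)
open import Relation.Binary.PropositionalEquality
  using (_≡_; _≢_; _≗_; refl; sym; trans; cong; cong₂; subst; subst₂; module ≡-Reasoning)
open import Relation.Nullary using (Dec; yes; no; does; _because_; ¬_; ¬?)
open import Relation.Nullary.Decidable using (_×-dec_; _→-dec_; dec-true; dec-false; does-⇔; toWitness)

indicator : ∀ {a} {A : Set a} → Dec A → ℕ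
indicator a? = if does a? then 1 else 0

indicator-yes : ∀ {a} {A : Set a} (a? : Dec A) → A → indicator a? ≡ 1
indicator-yes a? a = cong (if_then 1 else 0) (dec-true a? a)

indicator-no : ∀ {a} {A : Set a} (a? : Dec A) → ¬ A → indicator a? ≡ 0
indicator-no a? ¬a = cong (if_then 1 else 0) (dec-false a? ¬a)

indicator≤1 : ∀ {a} {A : Set a} (a? : Dec A) → indicator a? ≤ 1
indicator≤1 (yes _) = ≤-refl
indicator≤1 (no _)  = z≤n

indicator-⇔ : ∀ {a b} {A : Set a} {B : Set b} → A ⇔ B → (a? : Dec A) (b? : Dec B) →
              indicator a? ≡ indicator b?
indicator-⇔ A⇔B a? b? = cong (if_then 1 else 0) (does-⇔ A⇔B a? b?)

indicator-× : ∀ {a b} {A : Set a} {B : Set b} (a? : Dec A) (b? : Dec B) →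
              indicator (a? ×-dec b?) ≡ indicator a? * indicator b?
indicator-× (true  because _) (true  because _) = refl
indicator-× (true  because _) (false because _) = refl
indicator-× (false because _) _                 = refl

indicator-mono : ∀ {a b} {A : Set a} {B : Set b} → (A → B) → (a? : Dec A) (b? : Dec B) →
                 indicator a? ≤ indicator b?
indicator-mono A⇒B (yes a) (yes _) = ≤-refl
indicator-mono A⇒B (yes a) (no ¬b) = ⊥-elim (¬b (A⇒B a))
indicator-mono A⇒B (no _)  _       = z≤n

length-filter≡sum : ∀ {a p} {A : Set a} {P : A → Set p} (P? : ∀ x → Dec (P x)) xs →
                    length (filter P? xs) ≡ sum (map (λ x → indicator (P? x)) xs)
length-filter≡sum P? []       = refl
length-filter≡sum P? (x ∷ xs) with does (P? x)
... | true  = cong suc (length-filter≡sum P? xs)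
... | false = length-filter≡sum P? xs

sum-map-mono-≤ : ∀ {a} {A : Set a} {f g : A → ℕ} → (∀ x → f x ≤ g x) → ∀ xs →
                 sum (map f xs) ≤ sum (map g xs)
sum-map-mono-≤ f≤g []       = z≤n
sum-map-mono-≤ f≤g (x ∷ xs) = +-mono-≤ (f≤g x) (sum-map-mono-≤ f≤g xs)

sum-map-mono-< : ∀ {a} {A : Set a} {f g : A → ℕ} → (∀ x → f x ≤ g x) → ∀ {z xs} → z ∈ xs →
                 f z < g z → sum (map f xs) < sum (map g xs)
sum-map-mono-< f≤g {xs = x ∷ xs} (here refl) fz<gz = +-mono-<-≤ fz<gz (sum-map-mono-≤ f≤g xs)
sum-map-mono-< f≤g {xs = x ∷ xs} (there z∈xs) fz<gz = +-mono-≤-< (f≤g x) (sum-map-mono-< f≤g z∈xs fz<gz)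

sum-map-const : ∀ {a} {A : Set a} (xs : List A) → sum (map (λ _ → 1) xs) ≡ length xs
sum-map-const []       = refl
sum-map-const (x ∷ xs) = cong suc (sum-map-const xs)

-- Permutations induced by injective keys

injective⇒surjective : ∀ {n} {f : Fin n → Fin n} → Injective _≡_ _≡_ f → ∀ y → ∃ λ x → f x ≡ y
injective⇒surjective {suc n} {f} f-injective y with any? (λ x → f x ≟ᶠ y)
... | yes hit = hit
... | no miss = ⊥-elim (1+n≰n (injective⇒≤ avoid-injective))
  where
  avoid : Fin (suc n) → Fin n
  avoid x = punchOut (miss ∘ (x ,_) ∘ sym)
  avoid-injective : Injective _≡_ _≡_ avoid
  avoid-injective {x} {x′} =
    f-injective ∘ punchOut-injective {i = y} (miss ∘ (x ,_) ∘ sym) (miss ∘ (x′ ,_) ∘ sym)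

injective⇒permutation : ∀ {n} (f : Fin n → Fin n) → Injective _≡_ _≡_ f → Permutation′ n
injective⇒permutation f f-injective =
  permutation f (proj₁ ∘ onto) (proj₂ ∘ onto) (λ x → f-injective (proj₂ (onto (f x))))
  where onto = injective⇒surjective f-injective

module OrderBy {n} (κ : Fin n → ℕ) (κ-injective : Injective _≡_ _≡_ κ) where

  rank : Fin n → ℕ
  rank x = sum (map (λ y → indicator (κ y <? κ x)) (allFin n))

  rank-mono : ∀ {x y} → κ x < κ y → rank x < rank y
  rank-mono {x} {y} κx<κy = sum-map-mono-<
    (λ z → indicator-mono (λ κz<κx → <-trans κz<κx κx<κy) (κ z <? κ x) (κ z <? κ y))
    (∈-allFin x)
    (subst₂ _<_ (sym (indicator-no (κ x <? κ x) (<-irrefl refl))) (sym (indicator-yes (κ x <? κ y) κx<κy)) ≤-refl)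

  rank<n : ∀ x → rank x < n
  rank<n x = subst (rank x <_) (trans (sum-map-const (allFin n)) (length-tabulate _))
    (sum-map-mono-< (λ z → indicator≤1 (κ z <? κ x)) (∈-allFin x)
      (subst (_< 1) (sym (indicator-no (κ x <? κ x) (<-irrefl refl))) ≤-refl))

  rankᶠ : Fin n → Fin n
  rankᶠ x = fromℕ< (rank<n x)

  rankᶠ-mono : ∀ {x y} → κ x < κ y → rankᶠ x <ᶠ rankᶠ y
  rankᶠ-mono {x} {y} κx<κy =
    subst₂ _<_ (sym (toℕ-fromℕ< (rank<n x))) (sym (toℕ-fromℕ< (rank<n y))) (rank-mono κx<κy)

  rankᶠ-injective : Injective _≡_ _≡_ rankᶠ
  rankᶠ-injective {x} {y} rx≡ry with <-cmp (κ x) (κ y)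
  ... | tri< κx<κy _ _ = ⊥-elim (<ᶠ-irrefl rx≡ry (rankᶠ-mono κx<κy))
  ... | tri≈ _ κx≡κy _ = κ-injective κx≡κy
  ... | tri> _ _ κy<κx = ⊥-elim (<ᶠ-irrefl (sym rx≡ry) (rankᶠ-mono κy<κx))

  orderBy : Permutation′ n
  orderBy = injective⇒permutation rankᶠ rankᶠ-injective

  orderBy-mono : ∀ {x y} → κ x < κ y → orderBy ⟨$⟩ʳ x <ᶠ orderBy ⟨$⟩ʳ y
  orderBy-mono = rankᶠ-mono

-- Blowing up a family along a labelling

module BlowUp {m L n} (B : Family m L) (label : Fin n → Fin L) where

  key : Fin m → Fin n → ℕ
  key k x = toℕ (combine (B k ⟨$⟩ʳ label x) x)

  key-injective : ∀ k → Injective _≡_ _≡_ (key k)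
  key-injective k {x} {y} = combine-injectiveʳ (B k ⟨$⟩ʳ label x) x (B k ⟨$⟩ʳ label y) y ∘ toℕ-injective

  blowUp : Family m n
  blowUp k = OrderBy.orderBy (key k) (key-injective k)

  blowUp-mono : ∀ k {x y} → B k ⟨$⟩ʳ label x <ᶠ B k ⟨$⟩ʳ label y →
                blowUp k ⟨$⟩ʳ x <ᶠ blowUp k ⟨$⟩ʳ y
  blowUp-mono k {x} {y} = OrderBy.orderBy-mono (key k) (key-injective k) ∘ combine-monoˡ-< x y

  blowUp-realises : ∀ {x y z} → Realised B (label x) (label y) (label z) → Realised blowUp x y z
  blowUp-realises (k , x≺y , y≺z) = k , blowUp-mono k x≺y , blowUp-mono k y≺z

  blowUp-shatters : ∀ {a b c} → Shatters B (label a) (label b) (label c) → Shatters blowUp a b c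
  blowUp-shatters (abc , acb , bac , bca , cab , cba) =
    blowUp-realises abc , blowUp-realises acb , blowUp-realises bac ,
    blowUp-realises bca , blowUp-realises cab , blowUp-realises cba

  blowUp-separates : ∀ {i j x y} → B i ⟨$⟩ʳ label x <ᶠ B i ⟨$⟩ʳ label y →
                     B j ⟨$⟩ʳ label y <ᶠ B j ⟨$⟩ʳ label x → ¬ blowUp i ≈ blowUp j
  blowUp-separates {i} {j} {x} {y} x≺ᵢy y≺ⱼx i≈j =
    <ᶠ-asym (subst₂ _<ᶠ_ (i≈j x) (i≈j y) (blowUp-mono i x≺ᵢy)) (blowUp-mono j y≺ⱼx)

shatters-swap₁₂ : ∀ {m n} (F : Family m n) a b c → Shatters F a b c ⇔ Shatters F b a c
shatters-swap₁₂ F a b c = mk⇔ swap swap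
  where
  swap : ∀ {x y z} → Shatters F x y z → Shatters F y x z
  swap (xyz , xzy , yxz , yzx , zxy , zyx) = yxz , yzx , xyz , xzy , zyx , zxy

shatters-swap₂₃ : ∀ {m n} (F : Family m n) a b c → Shatters F a b c ⇔ Shatters F a c b
shatters-swap₂₃ F a b c = mk⇔ swap swap
  where
  swap : ∀ {x y z} → Shatters F x y z → Shatters F x z y
  swap (xyz , xzy , yxz , yzx , zxy , zyx) = xzy , xyz , zxy , zyx , yxz , yzx

¬shatters-repeated : ∀ {m n} (F : Family m n) a b → ¬ Shatters F a b b
¬shatters-repeated F a b ((k , _ , b≺b) , _) = <-irrefl refl b≺b

sumTo : ℕ → (ℕ → ℕ) → ℕ
sumTo zero    f = 0
sumTo (suc n) f = sumTo n f + f n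

sumTo-cong : ∀ n {f g} → (∀ i → i < n → f i ≡ g i) → sumTo n f ≡ sumTo n g
sumTo-cong zero    f≡g = refl
sumTo-cong (suc n) f≡g = cong₂ _+_ (sumTo-cong n (λ i i<n → f≡g i (m<n⇒m<1+n i<n))) (f≡g n (n<1+n n))

sumTo-zero : ∀ n → sumTo n (λ _ → 0) ≡ 0
sumTo-zero zero    = refl
sumTo-zero (suc n) = trans (+-identityʳ _) (sumTo-zero n)

sumTo-distrib-+ : ∀ n (f g : ℕ → ℕ) → sumTo n (λ i → f i + g i) ≡ sumTo n f + sumTo n g
sumTo-distrib-+ zero    f g = refl
sumTo-distrib-+ (suc n) f g =
  trans (cong (_+ (f n + g n)) (sumTo-distrib-+ n f g)) (interchange (sumTo n f) (sumTo n g) (f n) (g n))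
  where
  interchange : ∀ a b c d → (a + b) + (c + d) ≡ (a + c) + (b + d)
  interchange = solve-∀

sumTo-comm : ∀ m k (f : ℕ → ℕ → ℕ) →
             sumTo m (λ i → sumTo k (f i)) ≡ sumTo k (λ j → sumTo m (λ i → f i j))
sumTo-comm zero    k f = sym (sumTo-zero k)
sumTo-comm (suc m) k f =
  trans (cong (_+ sumTo k (f m)) (sumTo-comm m k f)) (sym (sumTo-distrib-+ k (λ j → sumTo m (λ i → f i j)) (f m)))

*-distribˡ-sumTo : ∀ c n (f : ℕ → ℕ) → c * sumTo n f ≡ sumTo n (λ i → c * f i)
*-distribˡ-sumTo c zero    f = *-zeroʳ c
*-distribˡ-sumTo c (suc n) f = trans (*-distribˡ-+ c (sumTo n f) (f n)) (cong (_+ c * f n) (*-distribˡ-sumTo c n f))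

sumTo-below : ∀ {m n} (f : ℕ → ℕ) → m ≤ n → sumTo n (λ i → indicator (i <? m) * f i) ≡ sumTo m f
sumTo-below {m} {zero}  f z≤n = refl
sumTo-below {m} {suc n} f m≤1+n with m≤n⇒m<n∨m≡n m≤1+n
... | inj₁ m<1+n = begin
  sumTo n (λ i → indicator (i <? m) * f i) + indicator (n <? m) * f n
    ≡⟨ cong₂ _+_ (sumTo-below f m≤n) (cong (_* f n) (indicator-no (n <? m) (≤⇒≯ m≤n))) ⟩
  sumTo m f + 0
    ≡⟨ +-identityʳ _ ⟩
  sumTo m f ∎
  where
  open ≡-Reasoning
  m≤n = m<1+n⇒m≤n m<1+n
... | inj₂ refl = cong₂ _+_ (sumTo-cong n (λ i i<n → selected i (m<n⇒m<1+n i<n))) (selected n (n<1+n n))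
  where
  selected : ∀ i → i < suc n → indicator (i <? suc n) * f i ≡ f i
  selected i i<1+n = trans (cong (_* f i) (indicator-yes (i <? suc n) i<1+n)) (+-identityʳ (f i))

sumTo-first : ∀ n (f : ℕ → ℕ) → sumTo (suc n) f ≡ f 0 + sumTo n (f ∘ suc)
sumTo-first zero    f = +-comm 0 (f 0)
sumTo-first (suc n) f = trans (cong (_+ f (suc n)) (sumTo-first n f)) (+-assoc (f 0) _ _)

sum-tabulate : ∀ n (f : ℕ → ℕ) → sum (tabulate {n = n} (f ∘ toℕ)) ≡ sumTo n f
sum-tabulate zero    f = refl
sum-tabulate (suc n) f = trans (cong (f 0 +_) (sum-tabulate n (f ∘ suc))) (sym (sumTo-first n f))

sum-allFin : ∀ n (f : ℕ → ℕ) → sum (map (f ∘ toℕ) (allFin n)) ≡ sumTo n f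
sum-allFin n f = trans (cong sum (map-tabulate {n = n} (λ i → i) (f ∘ toℕ))) (sum-tabulate n f)

sumTo-increasing : ∀ n (h : ℕ → ℕ → ℕ → ℕ) →
  sumTo n (λ a → sumTo n (λ b → sumTo n (λ c → indicator (a <? b) * (indicator (b <? c) * h a b c)))) ≡
  sumTo n (λ c → sumTo c (λ b → sumTo b (λ a → h a b c)))
sumTo-increasing n h = begin
  sumTo n (λ a → sumTo n (λ b → sumTo n (λ c → w a b c)))
    ≡⟨ sumTo-cong n (λ a _ → sumTo-comm n n (w a)) ⟩
  sumTo n (λ a → sumTo n (λ c → sumTo n (λ b → w a b c)))
    ≡⟨ sumTo-comm n n (λ a c → sumTo n (λ b → w a b c)) ⟩
  sumTo n (λ c → sumTo n (λ a → sumTo n (λ b → w a b c)))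
    ≡⟨ sumTo-cong n (λ c _ → sumTo-comm n n (λ a b → w a b c)) ⟩
  sumTo n (λ c → sumTo n (λ b → sumTo n (λ a → w a b c)))
    ≡⟨ sumTo-cong n (λ c c<n → below-c c (<⇒≤ c<n)) ⟩
  sumTo n (λ c → sumTo c (λ b → sumTo b (λ a → h a b c))) ∎
  where
  open ≡-Reasoning
  w : ℕ → ℕ → ℕ → ℕ
  w a b c = indicator (a <? b) * (indicator (b <? c) * h a b c)
  exchange : ∀ x y z → x * (y * z) ≡ y * (x * z)
  exchange = solve-∀
  below-c : ∀ c → c ≤ n →
            sumTo n (λ b → sumTo n (λ a → w a b c)) ≡ sumTo c (λ b → sumTo b (λ a → h a b c))
  below-c c c≤n = begin
    sumTo n (λ b → sumTo n (λ a → w a b c))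
      ≡⟨ sumTo-cong n (λ b _ → pull-out b) ⟩
    sumTo n (λ b → indicator (b <? c) * sumTo n (λ a → indicator (a <? b) * h a b c))
      ≡⟨ sumTo-below (λ b → sumTo n (λ a → indicator (a <? b) * h a b c)) c≤n ⟩
    sumTo c (λ b → sumTo n (λ a → indicator (a <? b) * h a b c))
      ≡⟨ sumTo-cong c (λ b b<c → sumTo-below (λ a → h a b c) (<⇒≤ (<-≤-trans b<c c≤n))) ⟩
    sumTo c (λ b → sumTo b (λ a → h a b c)) ∎
    where
    pull-out : ∀ b → sumTo n (λ a → w a b c) ≡ indicator (b <? c) * sumTo n (λ a → indicator (a <? b) * h a b c)
    pull-out b = trans (sumTo-cong n (λ a _ → exchange (indicator (a <? b)) (indicator (b <? c)) (h a b c)))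
                       (sym (*-distribˡ-sumTo (indicator (b <? c)) n (λ a → indicator (a <? b) * h a b c)))

sum-map-concatMap : ∀ {a b} {A : Set a} {B : Set b} (g : B → ℕ) (f : A → List B) xs →
                    sum (map g (concatMap f xs)) ≡ sum (map (λ x → sum (map g (f x))) xs)
sum-map-concatMap g f []       = refl
sum-map-concatMap g f (x ∷ xs) =
  trans (cong sum (map-++ g (f x) (concatMap f xs)))
    (trans (sum-++ (map g (f x)) (map g (concatMap f xs))) (cong (sum (map g (f x)) +_) (sum-map-concatMap g f xs)))

onTriple : ∀ {n} → (ℕ → ℕ → ℕ → ℕ) → Triple n → ℕ
onTriple g (a , b , c) = g (toℕ a) (toℕ b) (toℕ c)

sum-allTriples : ∀ n (g : ℕ → ℕ → ℕ → ℕ) →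
  sum (map (onTriple g) (allTriples n)) ≡ sumTo n (λ a → sumTo n (λ b → sumTo n (λ c → g a b c)))
sum-allTriples n g = begin
  sum (map (onTriple g) (allTriples n))
    ≡⟨ sum-map-concatMap (onTriple g) row (allFin n) ⟩
  sum (map (λ a → sum (map (onTriple g) (row a))) (allFin n))
    ≡⟨ cong sum (map-cong row-sum (allFin n)) ⟩
  sum (map (λ a → sumTo n (λ b → sumTo n (g (toℕ a) b))) (allFin n))
    ≡⟨ sum-allFin n (λ a → sumTo n (λ b → sumTo n (g a b))) ⟩
  sumTo n (λ a → sumTo n (λ b → sumTo n (λ c → g a b c))) ∎
  where
  open ≡-Reasoning
  row : Fin n → List (Triple n)
  row a = concatMap (λ b → map (λ c → (a , b , c)) (allFin n)) (allFin n)
  entry : ∀ a b → sum (map (onTriple g) (map (λ c → (a , b , c)) (allFin n))) ≡ sumTo n (g (toℕ a) (toℕ b))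
  entry a b = trans (cong sum (sym (map-∘ (allFin n)))) (sum-allFin n (g (toℕ a) (toℕ b)))
  row-sum : ∀ a → sum (map (onTriple g) (row a)) ≡ sumTo n (λ b → sumTo n (g (toℕ a) b))
  row-sum a = trans (sum-map-concatMap (onTriple g) _ (allFin n))
                    (trans (cong sum (map-cong (entry a) (allFin n))) (sum-allFin n (λ b → sumTo n (g (toℕ a) b))))

-- Trilinear forms on ℕ^L

infixl 6 _⊕_
infixr 7 _⊙_

_⊕_ : ∀ {L} → Vector ℕ L → Vector ℕ L → Vector ℕ L
_⊕_ = zipWith _+_

_⊙_ : ∀ {L} → ℕ → Vector ℕ L → Vector ℕ L
c ⊙ X = mapᵛ (c *_) X

δ : ∀ {L} → Fin L → Vector ℕ L
δ zero    zero    = 1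
δ zero    (suc _) = 0
δ (suc _) zero    = 0
δ (suc k) (suc i) = δ k i

⟨_,_⟩ : ∀ {L} → Vector ℕ L → Vector ℕ L → ℕ
⟨ X , F ⟩ = ∑ (λ i → X i * F i)

dot-comm : ∀ {L} (X F : Vector ℕ L) → ⟨ X , F ⟩ ≡ ⟨ F , X ⟩
dot-comm X F = sum-cong-≗ (λ i → *-comm (X i) (F i))

dot-congˡ : ∀ {L} {X Y : Vector ℕ L} (F : Vector ℕ L) → X ≗ Y → ⟨ X , F ⟩ ≡ ⟨ Y , F ⟩
dot-congˡ F X≗Y = sum-cong-≗ (λ i → cong (_* F i) (X≗Y i))

dot-congʳ : ∀ {L} (X : Vector ℕ L) {F G} → F ≗ G → ⟨ X , F ⟩ ≡ ⟨ X , G ⟩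
dot-congʳ X F≗G = sum-cong-≗ (λ i → cong (X i *_) (F≗G i))

dot-zeroʳ : ∀ {L} (X : Vector ℕ L) {F} → F ≗ (λ _ → 0) → ⟨ X , F ⟩ ≡ 0
dot-zeroʳ {L} X F≗0 =
  trans (sum-cong-≗ (λ i → trans (cong (X i *_) (F≗0 i)) (*-comm (X i) 0))) (sum-replicate-zero L)

dot-⊕ˡ : ∀ {L} (X Y F : Vector ℕ L) → ⟨ X ⊕ Y , F ⟩ ≡ ⟨ X , F ⟩ + ⟨ Y , F ⟩
dot-⊕ˡ X Y F =
  trans (sum-cong-≗ (λ i → *-distribʳ-+ (F i) (X i) (Y i))) (∑-distrib-+ (λ i → X i * F i) (λ i → Y i * F i))

dot-⊕ʳ : ∀ {L} (X F G : Vector ℕ L) → ⟨ X , F ⊕ G ⟩ ≡ ⟨ X , F ⟩ + ⟨ X , G ⟩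
dot-⊕ʳ X F G = begin
  ⟨ X , F ⊕ G ⟩          ≡⟨ dot-comm X (F ⊕ G) ⟩
  ⟨ F ⊕ G , X ⟩          ≡⟨ dot-⊕ˡ F G X ⟩
  ⟨ F , X ⟩ + ⟨ G , X ⟩  ≡⟨ cong₂ _+_ (dot-comm F X) (dot-comm G X) ⟩
  ⟨ X , F ⟩ + ⟨ X , G ⟩  ∎
  where open ≡-Reasoning

dot-⊙ˡ : ∀ {L} c (X F : Vector ℕ L) → ⟨ c ⊙ X , F ⟩ ≡ c * ⟨ X , F ⟩
dot-⊙ˡ c X F = trans (sum-cong-≗ (λ i → *-assoc c (X i) (F i))) (sym (*-distribˡ-sum c (λ i → X i * F i)))

dot-⊙ʳ : ∀ {L} c (X F : Vector ℕ L) → ⟨ X , c ⊙ F ⟩ ≡ c * ⟨ X , F ⟩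
dot-⊙ʳ c X F = trans (dot-comm X (c ⊙ F)) (trans (dot-⊙ˡ c F X) (cong (c *_) (dot-comm F X)))

dot-δˡ : ∀ {L} (k : Fin L) (F : Vector ℕ L) → ⟨ δ k , F ⟩ ≡ F k
dot-δˡ {suc L} zero    F =
  trans (cong₂ _+_ (+-identityʳ (F zero)) (sum-replicate-zero L)) (+-identityʳ (F zero))
dot-δˡ {suc L} (suc k) F = dot-δˡ k (λ i → F (suc i))

dot-swap : ∀ {L} (X Y : Vector ℕ L) (f : Fin L → Fin L → ℕ) →
           ⟨ X , (λ i → ⟨ Y , f i ⟩) ⟩ ≡ ⟨ Y , (λ j → ⟨ X , (λ i → f i j) ⟩) ⟩
dot-swap X Y f = begin
  ∑ (λ i → X i * ∑ (λ j → Y j * f i j))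
    ≡⟨ sum-cong-≗ (λ i → *-distribˡ-sum (X i) (λ j → Y j * f i j)) ⟩
  ∑ (λ i → ∑ (λ j → X i * (Y j * f i j)))
    ≡⟨ ∑-comm (λ i j → X i * (Y j * f i j)) ⟩
  ∑ (λ j → ∑ (λ i → X i * (Y j * f i j)))
    ≡⟨ sum-cong-≗ (λ j → sum-cong-≗ (λ i → exchange (X i) (Y j) (f i j))) ⟩
  ∑ (λ j → ∑ (λ i → Y j * (X i * f i j)))
    ≡⟨ sum-cong-≗ (λ j → *-distribˡ-sum (Y j) (λ i → X i * f i j)) ⟨
  ∑ (λ j → Y j * ∑ (λ i → X i * f i j)) ∎
  where
  open ≡-Reasoning
  exchange : ∀ x y z → x * (y * z) ≡ y * (x * z)
  exchange = solve-∀

trilinear : ∀ {L} → (Fin L → Fin L → Fin L → ℕ) → Vector ℕ L → Vector ℕ L → Vector ℕ L → ℕ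
trilinear s X Y Z = ⟨ X , (λ i → ⟨ Y , (λ j → ⟨ Z , s i j ⟩) ⟩) ⟩

cubic : ∀ {L} → (Fin L → Fin L → Fin L → ℕ) → Vector ℕ L → ℕ
cubic s X = trilinear s X X X

module _ {L} (s : Fin L → Fin L → Fin L → ℕ) where

  trilinear-cong : ∀ {X X′ Y Y′ Z Z′ : Vector ℕ L} → X ≗ X′ → Y ≗ Y′ → Z ≗ Z′ →
                   trilinear s X Y Z ≡ trilinear s X′ Y′ Z′
  trilinear-cong {X} {X′} {Y} {Y′} {Z} {Z′} X≗X′ Y≗Y′ Z≗Z′ =
    trans (dot-congˡ _ X≗X′)
          (dot-congʳ X′ (λ i → trans (dot-congˡ _ Y≗Y′) (dot-congʳ Y′ (λ j → dot-congˡ (s i j) Z≗Z′))))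

  trilinear-⊕₁ : ∀ X X′ Y Z → trilinear s (X ⊕ X′) Y Z ≡ trilinear s X Y Z + trilinear s X′ Y Z
  trilinear-⊕₁ X X′ Y Z = dot-⊕ˡ X X′ _

  trilinear-⊕₂ : ∀ X Y Y′ Z → trilinear s X (Y ⊕ Y′) Z ≡ trilinear s X Y Z + trilinear s X Y′ Z
  trilinear-⊕₂ X Y Y′ Z = trans (dot-congʳ X (λ i → dot-⊕ˡ Y Y′ _)) (dot-⊕ʳ X _ _)

  trilinear-⊕₃ : ∀ X Y Z Z′ → trilinear s X Y (Z ⊕ Z′) ≡ trilinear s X Y Z + trilinear s X Y Z′
  trilinear-⊕₃ X Y Z Z′ =
    trans (dot-congʳ X (λ i → trans (dot-congʳ Y (λ j → dot-⊕ˡ Z Z′ (s i j))) (dot-⊕ʳ Y _ _))) (dot-⊕ʳ X _ _)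

  trilinear-⊙₁ : ∀ c X Y Z → trilinear s (c ⊙ X) Y Z ≡ c * trilinear s X Y Z
  trilinear-⊙₁ c X Y Z = dot-⊙ˡ c X _

  trilinear-⊙₂ : ∀ c X Y Z → trilinear s X (c ⊙ Y) Z ≡ c * trilinear s X Y Z
  trilinear-⊙₂ c X Y Z = trans (dot-congʳ X (λ i → dot-⊙ˡ c Y _)) (dot-⊙ʳ c X _)

  trilinear-⊙₃ : ∀ c X Y Z → trilinear s X Y (c ⊙ Z) ≡ c * trilinear s X Y Z
  trilinear-⊙₃ c X Y Z =
    trans (dot-congʳ X (λ i → trans (dot-congʳ Y (λ j → dot-⊙ˡ c Z (s i j))) (dot-⊙ʳ c Y _))) (dot-⊙ʳ c X _)

  trilinear-δ₂₃ : ∀ X v w → trilinear s X (δ v) (δ w) ≡ ⟨ X , (λ u → s u v w) ⟩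
  trilinear-δ₂₃ X v w = dot-congʳ X (λ u → trans (dot-δˡ v _) (dot-δˡ w (s u v)))

record Symmetric {L} (s : Fin L → Fin L → Fin L → ℕ) : Set where
  field
    swap₁₂ : ∀ i j l → s i j l ≡ s j i l
    swap₂₃ : ∀ i j l → s i j l ≡ s i l j

module _ {L} {s : Fin L → Fin L → Fin L → ℕ} (s-symmetric : Symmetric s) where
  open Symmetric s-symmetric

  trilinear-swap₁₂ : ∀ X Y Z → trilinear s X Y Z ≡ trilinear s Y X Z
  trilinear-swap₁₂ X Y Z =
    trans (dot-swap X Y (λ i j → ⟨ Z , s i j ⟩))
          (dot-congʳ Y (λ j → dot-congʳ X (λ i → dot-congʳ Z (swap₁₂ i j))))

  trilinear-swap₂₃ : ∀ X Y Z → trilinear s X Y Z ≡ trilinear s X Z Y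
  trilinear-swap₂₃ X Y Z =
    dot-congʳ X (λ i → trans (dot-swap Y Z (s i)) (dot-congʳ Z (λ l → dot-congʳ Y (λ j → swap₂₃ i j l))))

  trilinear-square : ∀ X Y Z →
    trilinear s (X ⊕ Y) (X ⊕ Y) Z ≡ trilinear s X X Z + 2 * trilinear s X Y Z + trilinear s Y Y Z
  trilinear-square X Y Z = begin
    trilinear s (X ⊕ Y) (X ⊕ Y) Z
      ≡⟨ trilinear-⊕₁ s X Y (X ⊕ Y) Z ⟩
    trilinear s X (X ⊕ Y) Z + trilinear s Y (X ⊕ Y) Z
      ≡⟨ cong₂ _+_ (trilinear-⊕₂ s X X Y Z) (trilinear-⊕₂ s Y X Y Z) ⟩
    (trilinear s X X Z + trilinear s X Y Z) + (trilinear s Y X Z + trilinear s Y Y Z)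
      ≡⟨ cong (λ t → (trilinear s X X Z + trilinear s X Y Z) + (t + trilinear s Y Y Z))
              (trilinear-swap₁₂ Y X Z) ⟩
    (trilinear s X X Z + trilinear s X Y Z) + (trilinear s X Y Z + trilinear s Y Y Z)
      ≡⟨ collect (trilinear s X X Z) (trilinear s X Y Z) (trilinear s Y Y Z) ⟩
    trilinear s X X Z + 2 * trilinear s X Y Z + trilinear s Y Y Z ∎
    where
    open ≡-Reasoning
    collect : ∀ a b c → (a + b) + (b + c) ≡ a + 2 * b + c
    collect = solve-∀

  cubic-⊕ : ∀ X Y →
    cubic s (X ⊕ Y) ≡ cubic s X + 3 * trilinear s X X Y + 3 * trilinear s X Y Y + cubic s Y
  cubic-⊕ X Y = begin
    cubic s (X ⊕ Y)
      ≡⟨ trilinear-⊕₃ s (X ⊕ Y) (X ⊕ Y) X Y ⟩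
    trilinear s (X ⊕ Y) (X ⊕ Y) X + trilinear s (X ⊕ Y) (X ⊕ Y) Y
      ≡⟨ cong₂ _+_ (trilinear-square X Y X) (trilinear-square X Y Y) ⟩
    (cubic s X + 2 * trilinear s X Y X + trilinear s Y Y X) + (trilinear s X X Y + 2 * trilinear s X Y Y + cubic s Y)
      ≡⟨ cong₂ (λ t t′ → (cubic s X + 2 * t + t′) + (trilinear s X X Y + 2 * trilinear s X Y Y + cubic s Y))
               (trilinear-swap₂₃ X Y X)
               (trans (trilinear-swap₂₃ Y Y X) (trilinear-swap₁₂ Y X Y)) ⟩
    (cubic s X + 2 * trilinear s X X Y + trilinear s X Y Y) + (trilinear s X X Y + 2 * trilinear s X Y Y + cubic s Y)
      ≡⟨ collect (cubic s X) (trilinear s X X Y) (trilinear s X Y Y) (cubic s Y) ⟩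
    cubic s X + 3 * trilinear s X X Y + 3 * trilinear s X Y Y + cubic s Y ∎
    where
    open ≡-Reasoning
    collect : ∀ a b c d → (a + 2 * b + c) + (b + 2 * c + d) ≡ a + 3 * b + 3 * c + d
    collect = solve-∀

  cubic-affine : ∀ c A B → cubic s (c ⊙ A ⊕ B) ≡
    c * (c * (c * cubic s A)) + 3 * (c * (c * trilinear s A A B)) + 3 * (c * trilinear s A B B) + cubic s B
  cubic-affine c A B = trans (cubic-⊕ (c ⊙ A) B) (cong₃ (λ x y z → x + 3 * y + 3 * z + cubic s B)
    (trans (trilinear-⊙₁ s c A (c ⊙ A) (c ⊙ A))
      (cong (c *_) (trans (trilinear-⊙₂ s c A A (c ⊙ A)) (cong (c *_) (trilinear-⊙₃ s c A A A)))))
    (trans (trilinear-⊙₁ s c A (c ⊙ A) B) (cong (c *_) (trilinear-⊙₂ s c A A B)))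
    (trilinear-⊙₁ s c A B B))
    where
    cong₃ : ∀ (f : ℕ → ℕ → ℕ → ℕ) {x x′ y y′ z z′} → x ≡ x′ → y ≡ y′ → z ≡ z′ →
            f x y z ≡ f x′ y′ z′
    cong₃ f refl refl refl = refl

trilinear-repeated₂₃ : ∀ {L} {s : Fin L → Fin L → Fin L → ℕ} → (∀ i k → s i k k ≡ 0) →
                       ∀ X k → trilinear s X (δ k) (δ k) ≡ 0
trilinear-repeated₂₃ {s = s} s-diagonal X k =
  trans (trilinear-δ₂₃ s X k k) (dot-zeroʳ X (λ u → s-diagonal u k))

trilinear-repeated₁₂ : ∀ {L} {s : Fin L → Fin L → Fin L → ℕ} → Symmetric s → (∀ i k → s i k k ≡ 0) →
                       ∀ k Z → trilinear s (δ k) (δ k) Z ≡ 0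
trilinear-repeated₁₂ s-symmetric s-diagonal k Z =
  trans (trilinear-swap₂₃ s-symmetric (δ k) (δ k) Z)
    (trans (trilinear-swap₁₂ s-symmetric (δ k) Z (δ k)) (trilinear-repeated₂₃ s-diagonal Z k))

-- Counting labelled triples by block sizes

module Counting {L} (label : ℕ → Fin L) (s : Fin L → Fin L → Fin L → ℕ) where

  blocks : ℕ → Vector ℕ L
  blocks zero    = λ _ → 0
  blocks (suc b) = blocks b ⊕ δ (label b)

  pairCount : Fin L → ℕ → ℕ
  pairCount t m = sumTo m (λ b → sumTo b (λ a → s (label a) (label b) t))

  tripleCount : ℕ → ℕ
  tripleCount n = sumTo n (λ c → pairCount (label c) c)

  sumTo-label : ∀ b f → sumTo b (f ∘ label) ≡ ⟨ blocks b , f ⟩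
  sumTo-label zero    f = sym (sum-replicate-zero L)
  sumTo-label (suc b) f =
    trans (cong₂ _+_ (sumTo-label b f) (sym (dot-δˡ (label b) f))) (sym (dot-⊕ˡ (blocks b) (δ (label b)) f))

  module _ (s-symmetric : Symmetric s) (s-diagonal : ∀ i k → s i k k ≡ 0) where
    open ≡-Reasoning

    pairCount-trilinear : ∀ t m → 2 * pairCount t m ≡ trilinear s (blocks m) (blocks m) (δ t)
    pairCount-trilinear t zero    = sym (sum-replicate-zero L)
    pairCount-trilinear t (suc m) = begin
      2 * (pairCount t m + sumTo m (λ a → s (label a) k t))
        ≡⟨ *-distribˡ-+ 2 (pairCount t m) _ ⟩
      2 * pairCount t m + 2 * sumTo m (λ a → s (label a) k t)
        ≡⟨ cong₂ (λ x y → x + 2 * y) (pairCount-trilinear t m) (sumTo-label m (λ u → s u k t)) ⟩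
      trilinear s N N (δ t) + 2 * ⟨ N , (λ u → s u k t) ⟩
        ≡⟨ cong (λ y → trilinear s N N (δ t) + 2 * y) (sym (trilinear-δ₂₃ s N k t)) ⟩
      trilinear s N N (δ t) + 2 * trilinear s N (δ k) (δ t)
        ≡⟨ sym (+-identityʳ _) ⟩
      trilinear s N N (δ t) + 2 * trilinear s N (δ k) (δ t) + 0
        ≡⟨ cong (trilinear s N N (δ t) + 2 * trilinear s N (δ k) (δ t) +_)
                (sym (trilinear-repeated₁₂ s-symmetric s-diagonal k (δ t))) ⟩
      trilinear s N N (δ t) + 2 * trilinear s N (δ k) (δ t) + trilinear s (δ k) (δ k) (δ t)
        ≡⟨ sym (trilinear-square s-symmetric N (δ k) (δ t)) ⟩
      trilinear s (N ⊕ δ k) (N ⊕ δ k) (δ t) ∎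
      where
      N = blocks m
      k = label m

    tripleCount-cubic : ∀ n → 6 * tripleCount n ≡ cubic s (blocks n)
    tripleCount-cubic zero    = sym (sum-replicate-zero L)
    tripleCount-cubic (suc n) = begin
      6 * (tripleCount n + pairCount k n)
        ≡⟨ regroup (tripleCount n) (pairCount k n) ⟩
      6 * tripleCount n + 3 * (2 * pairCount k n)
        ≡⟨ cong₂ (λ x y → x + 3 * y) (tripleCount-cubic n) (pairCount-trilinear k n) ⟩
      cubic s N + 3 * trilinear s N N (δ k)
        ≡⟨ pad (cubic s N + 3 * trilinear s N N (δ k)) ⟩
      cubic s N + 3 * trilinear s N N (δ k) + 3 * 0 + 0
        ≡⟨ cong₂ (λ x y → cubic s N + 3 * trilinear s N N (δ k) + 3 * x + y)
                 (sym (trilinear-repeated₂₃ s-diagonal N k))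
                 (sym (trilinear-repeated₁₂ s-symmetric s-diagonal k (δ k))) ⟩
      cubic s N + 3 * trilinear s N N (δ k) + 3 * trilinear s N (δ k) (δ k) + cubic s (δ k)
        ≡⟨ sym (cubic-⊕ s-symmetric N (δ k)) ⟩
      cubic s (N ⊕ δ k) ∎
      where
      N = blocks n
      k = label n
      regroup : ∀ a b → 6 * (a + b) ≡ 6 * a + 3 * (2 * b)
      regroup = solve-∀
      pad : ∀ a → a ≡ a + 3 * 0 + 0
      pad = solve-∀

2*nC2+n≡n*n : ∀ n → 2 * (n C 2) + n ≡ n * n
2*nC2+n≡n*n zero    = refl
2*nC2+n≡n*n (suc n) = begin
  2 * (suc n C 2) + suc n          ≡⟨ cong (λ x → 2 * x + suc n) (sym (nCk+nC[k+1]≡[n+1]C[k+1] n 1)) ⟩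
  2 * (n C 1 + n C 2) + suc n      ≡⟨ cong (λ x → 2 * (x + n C 2) + suc n) (nC1≡n n) ⟩
  2 * (n + n C 2) + suc n          ≡⟨ regroup n (n C 2) ⟩
  (2 * (n C 2) + n) + (2 * n + 1)  ≡⟨ cong (_+ (2 * n + 1)) (2*nC2+n≡n*n n) ⟩
  n * n + (2 * n + 1)              ≡⟨ square n ⟩
  suc n * suc n                    ∎
  where
  open ≡-Reasoning
  regroup : ∀ n x → 2 * (n + x) + suc n ≡ (2 * x + n) + (2 * n + 1)
  regroup = solve-∀
  square : ∀ n → n * n + (2 * n + 1) ≡ suc n * suc n
  square = solve-∀

6*nC3+3*n*n≡n*n*n+2*n : ∀ n → 6 * (n C 3) + 3 * (n * n) ≡ n * n * n + 2 * n
6*nC3+3*n*n≡n*n*n+2*n zero    = refl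
6*nC3+3*n*n≡n*n*n+2*n (suc n) = begin
  6 * (suc n C 3) + 3 * (suc n * suc n)
    ≡⟨ cong (λ x → 6 * x + 3 * (suc n * suc n)) (sym (nCk+nC[k+1]≡[n+1]C[k+1] n 2)) ⟩
  6 * (n C 2 + n C 3) + 3 * (suc n * suc n)
    ≡⟨ regroup n (n C 2) (n C 3) ⟩
  (6 * (n C 3) + 3 * (n * n)) + 3 * (2 * (n C 2) + n) + 3 * n + 3
    ≡⟨ cong₂ (λ x y → x + 3 * y + 3 * n + 3) (6*nC3+3*n*n≡n*n*n+2*n n) (2*nC2+n≡n*n n) ⟩
  (n * n * n + 2 * n) + 3 * (n * n) + 3 * n + 3
    ≡⟨ cube n ⟩
  suc n * suc n * suc n + 2 * suc n ∎
  where
  open ≡-Reasoning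
  regroup : ∀ n x y → 6 * (x + y) + 3 * (suc n * suc n) ≡ (6 * y + 3 * (n * n)) + 3 * (2 * x + n) + 3 * n + 3
  regroup = solve-∀
  cube : ∀ n → (n * n * n + 2 * n) + 3 * (n * n) + 3 * n + 3 ≡ suc n * suc n * suc n + 2 * suc n
  cube = solve-∀

excess⇒binomial-bound : ∀ n t e → t + 6 * (n * n) ≡ 2 * (n * n * n) + 4 * n + e → 2 * (6 * (n C 3)) ≤ t
excess⇒binomial-bound n t e identity = subst (2 * (6 * (n C 3)) ≤_) (+-cancelʳ-≡ (6 * (n * n)) _ _ (begin
  2 * (6 * (n C 3)) + e + 6 * (n * n)        ≡⟨ regroup (6 * (n C 3)) e (n * n) ⟩
  2 * (6 * (n C 3) + 3 * (n * n)) + e        ≡⟨ cong (λ x → 2 * x + e) (6*nC3+3*n*n≡n*n*n+2*n n) ⟩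
  2 * (n * n * n + 2 * n) + e                ≡⟨ expand (n * n * n) n e ⟩
  2 * (n * n * n) + 4 * n + e                ≡⟨ identity ⟨
  t + 6 * (n * n)                            ∎)) (m≤m+n _ e)
  where
  open ≡-Reasoning
  regroup : ∀ c e x → 2 * c + e + 6 * x ≡ 2 * (c + 3 * x) + e
  regroup = solve-∀
  expand : ∀ x n e → 2 * (x + 2 * n) + e ≡ 2 * x + 4 * n + e
  expand = solve-∀

-- The six base orderings and their blow-up

-- Row k lists the σₖ-position of each label. Read off, σ₀, …, σ₅ are the orders 013245, 230541,
-- 410253, 453021, 315420, 521043, which shatter every label triple except 013, 024, 025, 125, 345.
positions : Vec (Vec (Fin 6) 6) 6
positions = (0F ∷ 1F ∷ 3F ∷ 2F ∷ 4F ∷ 5F ∷ [])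
          ∷ (2F ∷ 5F ∷ 0F ∷ 1F ∷ 4F ∷ 3F ∷ [])
          ∷ (2F ∷ 1F ∷ 3F ∷ 5F ∷ 0F ∷ 4F ∷ [])
          ∷ (3F ∷ 5F ∷ 4F ∷ 2F ∷ 0F ∷ 1F ∷ [])
          ∷ (5F ∷ 1F ∷ 4F ∷ 0F ∷ 3F ∷ 2F ∷ [])
          ∷ (3F ∷ 2F ∷ 1F ∷ 5F ∷ 4F ∷ 0F ∷ [])
          ∷ []

σ : Fin 6 → Fin 6 → Fin 6
σ k = lookup (lookup positions k)

σ-injective : ∀ k → Injective _≡_ _≡_ (σ k)
σ-injective k {x} {y} =
  toWitness {a? = all? λ k → all? λ x → all? λ y → σ k x ≟ᶠ σ k y →-dec x ≟ᶠ y} _ k x y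

base : Family 6 6
base k = injective⇒permutation (σ k) (σ-injective k)

shattered : Fin 6 → Fin 6 → Fin 6 → ℕ
shattered u v w = indicator (shatters? base u v w)

shattered-symmetric : Symmetric shattered
shattered-symmetric = record
  { swap₁₂ = λ i j l → indicator-⇔ (shatters-swap₁₂ base i j l) (shatters? base i j l) (shatters? base j i l)
  ; swap₂₃ = λ i j l → indicator-⇔ (shatters-swap₂₃ base i j l) (shatters? base i j l) (shatters? base i l j)
  }

shattered-diagonal : ∀ i k → shattered i k k ≡ 0
shattered-diagonal i k = indicator-no (shatters? base i k k) (¬shatters-repeated base i k)

cycle : Fin 6 → Fin 6
cycle = lookup (1F ∷ 2F ∷ 3F ∷ 4F ∷ 5F ∷ 0F ∷ [])

label : ℕ → Fin 6
label zero    = 0F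
label (suc a) = cycle (label a)

family : ∀ n → Family 6 n
family n = BlowUp.blowUp base (label ∘ toℕ)

Before : Fin 6 → Fin 6 → Fin 6 → Set
Before k u v = base k ⟨$⟩ʳ u <ᶠ base k ⟨$⟩ʳ v

base-separates : ∀ i j → i ≢ j → ∃₂ λ (u v : Fin 3) →
  Before i (label (toℕ u)) (label (toℕ v)) × Before j (label (toℕ v)) (label (toℕ u))
base-separates = toWitness {a? = all? λ i → all? λ j → ¬? (i ≟ᶠ j) →-dec any? λ u → any? λ v →
  before? i (label (toℕ u)) (label (toℕ v)) ×-dec before? j (label (toℕ v)) (label (toℕ u))} _
  where
  before? : ∀ k u v → Dec (Before k u v)
  before? k u v = base k ⟨$⟩ʳ u <ᶠ? base k ⟨$⟩ʳ v

family-distinct : ∀ m → Distinct (family (3 + m))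
family-distinct m i j i≢j with base-separates i j i≢j
... | u , v , u≺ᵢv , v≺ⱼu =
  BlowUp.blowUp-separates base (label ∘ toℕ) {i} {j} {u ↑ˡ m} {v ↑ˡ m} (lift i u v u≺ᵢv) (lift j v u v≺ⱼu)
  where
  lift : ∀ k (u v : Fin 3) → Before k (label (toℕ u)) (label (toℕ v)) →
         Before k (label (toℕ (u ↑ˡ m))) (label (toℕ (v ↑ˡ m)))
  lift k u v = subst₂ (λ x y → Before k (label x) (label y)) (sym (toℕ-↑ˡ u m)) (sym (toℕ-↑ˡ v m))

open Counting label shattered

tripleCount≤numShattered : ∀ n → tripleCount n ≤ numShattered (family n)
tripleCount≤numShattered n = begin
  tripleCount n
    ≡⟨ sumTo-increasing n h ⟨
  sumTo n (λ a → sumTo n (λ b → sumTo n (λ c → indicator (a <? b) * (indicator (b <? c) * h a b c))))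
    ≡⟨ sumTo-cong n (λ a _ → sumTo-cong n (λ b _ → sumTo-cong n (λ c _ → split a b c))) ⟨
  sumTo n (λ a → sumTo n (λ b → sumTo n (λ c → indicator (ordered? a b c))))
    ≡⟨ sum-allTriples n (λ a b c → indicator (ordered? a b c)) ⟨
  sum (map (onTriple (λ a b c → indicator (ordered? a b c))) (allTriples n))
    ≤⟨ sum-map-mono-≤ lift (allTriples n) ⟩
  sum (map (λ t → indicator (isShatteredSet? (family n) t)) (allTriples n))
    ≡⟨ length-filter≡sum (isShatteredSet? (family n)) (allTriples n) ⟨
  numShattered (family n) ∎
  where
  open ≤-Reasoning
  h : ℕ → ℕ → ℕ → ℕ
  h a b c = shattered (label a) (label b) (label c)
  ordered? : ∀ a b c → Dec (a < b × b < c × Shatters base (label a) (label b) (label c))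
  ordered? a b c = (a <? b) ×-dec (b <? c) ×-dec shatters? base (label a) (label b) (label c)
  split : ∀ a b c → indicator (ordered? a b c) ≡ indicator (a <? b) * (indicator (b <? c) * h a b c)
  split a b c = trans (indicator-× (a <? b) ((b <? c) ×-dec shatters? base (label a) (label b) (label c)))
                      (cong (indicator (a <? b) *_) (indicator-× (b <? c) (shatters? base (label a) (label b) (label c))))
  lift : ∀ t → onTriple (λ a b c → indicator (ordered? a b c)) t ≤ indicator (isShatteredSet? (family n) t)
  lift t@(a , b , c) = indicator-mono (λ (a<b , b<c , S) → a<b , b<c , BlowUp.blowUp-shatters base (label ∘ toℕ) S)
                                      (ordered? (toℕ a) (toℕ b) (toℕ c)) (isShatteredSet? (family n) t)

𝟙 : Vector ℕ 6
𝟙 _ = 1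

blocks-period : ∀ b → blocks (6 + b) ≗ blocks b ⊕ 𝟙
blocks-period b i = trans (reassoc (blocks b i) _ _ _ _ _ _) (cong (blocks b i +_) (covers (label b) i))
  where
  reassoc : ∀ x a b c d e f → x + a + b + c + d + e + f ≡ x + (a + b + c + d + e + f)
  reassoc = solve-∀
  covers : ∀ k i → δ k i + δ (cycle k) i + δ (cycle (cycle k)) i + δ (cycle (cycle (cycle k))) i
                 + δ (cycle (cycle (cycle (cycle k)))) i + δ (cycle (cycle (cycle (cycle (cycle k))))) i ≡ 1
  covers = toWitness {a? = all? λ k → all? λ i → _ ≟ 1} _

blocks-residue : ∀ Q R → blocks (Q * 6 + R) ≗ Q ⊙ 𝟙 ⊕ blocks R
blocks-residue zero    R i = refl
blocks-residue (suc Q) R i =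
  trans (blocks-period (Q * 6 + R) i) (trans (cong (_+ 1) (blocks-residue Q R i)) (+-comm _ 1))

tripleCount-residue : ∀ Q R → 6 * tripleCount (Q * 6 + R) ≡
  Q * (Q * (Q * cubic shattered 𝟙)) + 3 * (Q * (Q * trilinear shattered 𝟙 𝟙 (blocks R)))
    + 3 * (Q * trilinear shattered 𝟙 (blocks R) (blocks R)) + cubic shattered (blocks R)
tripleCount-residue Q R = begin
  6 * tripleCount (Q * 6 + R)           ≡⟨ tripleCount-cubic shattered-symmetric shattered-diagonal (Q * 6 + R) ⟩
  cubic shattered (blocks (Q * 6 + R))  ≡⟨ trilinear-cong shattered N≗ N≗ N≗ ⟩
  cubic shattered (Q ⊙ 𝟙 ⊕ blocks R)    ≡⟨ cubic-affine shattered-symmetric Q 𝟙 (blocks R) ⟩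
  _ ∎
  where
  open ≡-Reasoning
  N≗ = blocks-residue Q R

cubic-𝟙 : cubic shattered 𝟙 ≡ 90
cubic-𝟙 = refl

-- The form values are passed as literals checked once by refl; leaving them unevaluated inside
-- the polynomial identities makes every conversion check recompute them.
form-values⇒residue-bound : ∀ Q R a b c {e} →
  trilinear shattered 𝟙 𝟙 (blocks R) ≡ a → trilinear shattered 𝟙 (blocks R) (blocks R) ≡ b →
  cubic shattered (blocks R) ≡ c →
  (let n = Q * 6 + R in
   5 * (Q * (Q * (Q * 90)) + 3 * (Q * (Q * a)) + 3 * (Q * b) + c) + 6 * (n * n) ≡ 2 * (n * n * n) + 4 * n + e) →
  2 * (6 * ((Q * 6 + R) C 3)) ≤ 5 * (6 * tripleCount (Q * 6 + R))
form-values⇒residue-bound Q R _ _ _ refl refl refl identity =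
  excess⇒binomial-bound n _ _ (trans (cong (λ x → 5 * x + 6 * (n * n)) polynomial) identity)
  where
  open ≡-Reasoning
  n = Q * 6 + R
  a = trilinear shattered 𝟙 𝟙 (blocks R)
  b = trilinear shattered 𝟙 (blocks R) (blocks R)
  c = cubic shattered (blocks R)
  polynomial : 6 * tripleCount n ≡ Q * (Q * (Q * 90)) + 3 * (Q * (Q * a)) + 3 * (Q * b) + c
  polynomial = begin
    6 * tripleCount n
      ≡⟨ tripleCount-residue Q R ⟩
    Q * (Q * (Q * cubic shattered 𝟙)) + 3 * (Q * (Q * a)) + 3 * (Q * b) + c
      ≡⟨ cong (λ x → Q * (Q * (Q * x)) + 3 * (Q * (Q * a)) + 3 * (Q * b) + c) cubic-𝟙 ⟩
    Q * (Q * (Q * 90)) + 3 * (Q * (Q * a)) + 3 * (Q * b) + c ∎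

-- Residues are taken in 1, …, 6: for n = 6Q the excess 18Q³ + 216Q² − 24Q has a negative coefficient.
residue-bound : ∀ Q r → r < 6 → let n = Q * 6 + suc r in 2 * (6 * (n C 3)) ≤ 5 * (6 * tripleCount n)
residue-bound Q 0 _ = form-values⇒residue-bound Q 1 14 0 0 refl refl refl (excess Q)
  where
  excess : ∀ Q → let n = Q * 6 + 1 in
    5 * (Q * (Q * (Q * 90)) + 3 * (Q * (Q * 14)) + 3 * (Q * 0) + 0) + 6 * (n * n)
      ≡ 2 * (n * n * n) + 4 * n + (12 * Q + 210 * (Q * Q) + 18 * (Q * Q * Q))
  excess = solve-∀
residue-bound Q 1 _ = form-values⇒residue-bound Q 2 30 6 0 refl refl refl (excess Q)
  where
  excess : ∀ Q → let n = Q * 6 + 2 in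
    5 * (Q * (Q * (Q * 90)) + 3 * (Q * (Q * 30)) + 3 * (Q * 6) + 0) + 6 * (n * n)
      ≡ 2 * (n * n * n) + 4 * n + (66 * Q + 234 * (Q * Q) + 18 * (Q * Q * Q))
  excess = solve-∀
residue-bound Q 2 _ = form-values⇒residue-bound Q 3 44 16 6 refl refl refl (excess Q)
  where
  excess : ∀ Q → let n = Q * 6 + 3 in
    5 * (Q * (Q * (Q * 90)) + 3 * (Q * (Q * 44)) + 3 * (Q * 16) + 6) + 6 * (n * n)
      ≡ 2 * (n * n * n) + 4 * n + (18 + 108 * Q + 228 * (Q * Q) + 18 * (Q * Q * Q))
  excess = solve-∀
residue-bound Q 3 _ = form-values⇒residue-bound Q 4 60 36 18 refl refl refl (excess Q)
  where
  excess : ∀ Q → let n = Q * 6 + 4 in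
    5 * (Q * (Q * (Q * 90)) + 3 * (Q * (Q * 60)) + 3 * (Q * 36) + 18) + 6 * (n * n)
      ≡ 2 * (n * n * n) + 4 * n + (42 + 228 * Q + 252 * (Q * Q) + 18 * (Q * Q * Q))
  excess = solve-∀
residue-bound Q 4 _ = form-values⇒residue-bound Q 5 76 62 48 refl refl refl (excess Q)
  where
  excess : ∀ Q → let n = Q * 6 + 5 in
    5 * (Q * (Q * (Q * 90)) + 3 * (Q * (Q * 76)) + 3 * (Q * 62) + 48) + 6 * (n * n)
      ≡ 2 * (n * n * n) + 4 * n + (120 + 366 * Q + 276 * (Q * Q) + 18 * (Q * Q * Q))
  excess = solve-∀
residue-bound Q 5 _ = form-values⇒residue-bound Q 6 90 90 90 refl refl refl (excess Q)
  where
  excess : ∀ Q → let n = Q * 6 + 6 in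
    5 * (Q * (Q * (Q * 90)) + 3 * (Q * (Q * 90)) + 3 * (Q * 90) + 90) + 6 * (n * n)
      ≡ 2 * (n * n * n) + 4 * n + (210 + 462 * Q + 270 * (Q * Q) + 18 * (Q * Q * Q))
  excess = solve-∀
residue-bound Q (suc (suc (suc (suc (suc (suc r)))))) (s≤s (s≤s (s≤s (s≤s (s≤s (s≤s ()))))))

tripleCount-bound : ∀ n → 2 * (n C 3) ≤ 5 * tripleCount n
tripleCount-bound zero    = z≤n
tripleCount-bound (suc m) = *-cancelˡ-≤ 6 (subst₂ _≤_ (exchange 2 6 (suc m C 3)) (exchange 5 6 (tripleCount (suc m)))
  (subst (λ n → 2 * (6 * (n C 3)) ≤ 5 * (6 * tripleCount n)) (sym n≡Q*6+R)
    (residue-bound (m / 6) (m % 6) (m%n<n m 6))))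
  where
  exchange : ∀ a b x → a * (b * x) ≡ b * (a * x)
  exchange = solve-∀
  n≡Q*6+R : suc m ≡ m / 6 * 6 + suc (m % 6)
  n≡Q*6+R = trans (cong suc (trans (m≡m%n+[m/n]*n m 6) (+-comm (m % 6) (m / 6 * 6)))) (sym (+-suc (m / 6 * 6) (m % 6)))

theorem3p3 : (n : ℕ) → 3 ≤ n → F3≥ n 6 2 5
theorem3p3 (suc (suc (suc m))) (s≤s (s≤s (s≤s _))) =
  family n , family-distinct m , ≤-trans (tripleCount-bound n) (*-monoʳ-≤ 5 (tripleCount≤numShattered n))
  where n = 3 + m
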